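{- Let $\Omega=\{s_1,\dots,s_m\}$ and $S_1,S_2\subset\Omega$. Then the following two conditions cannot happen simultaneously: (1) there is a linear ordering of the elements of $\Omega$ such that the elements of $S_1$ and of $S_2$ are both flushed Left; (2) there is a linear ordering of the elements of $\Omega$ such that the elements of $S_1$ are flushed Left while the elements of $S_2$ are flushed Right.
   Context: For a linear ordering $s_{\sigma(1)},\dots,s_{\sigma(m)}$ of $\Omega$ and $S\subseteq\Omega$: the elements of $S$ are flushed Left if they occupy consecutive positions and $s_{\sigma(1)}\in S$; they are flushed Right if they occupy consecutive positions and $s_{\sigma(m)}\in S$. -}

module Defs where

open import Data.Nat using (ℕ; _≡ᵇ_; suc)
open import Data.Fin using (Fin; toℕ; _≤_)
open import Data.Fin.Subset using (Subset; _∈_)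
open import Data.Fin.Permutation using (Permutation′; _⟨$⟩ʳ_)
open import Data.Product using (Σ; _×_)
open import Relation.Binary.PropositionalEquality using (_≡_)

-- Ω = {s_1,…,s_m} is modelled as Fin m.
-- A linear ordering s_{σ(1)},…,s_{σ(m)} is a permutation σ : positions → elements.

Consecutive : {m : ℕ} → Permutation′ m → Subset m → Set
Consecutive {m} σ S =
  (i j k : Fin m) → i ≤ k → k ≤ j →
  (σ ⟨$⟩ʳ i) ∈ S → (σ ⟨$⟩ʳ j) ∈ S → (σ ⟨$⟩ʳ k) ∈ S

FlushedLeft : {m : ℕ} → Permutation′ m → Subset m → Set
FlushedLeft {m} σ S =
  Consecutive σ S × Σ (Fin m) (λ i → toℕ i ≡ 0 × (σ ⟨$⟩ʳ i) ∈ S)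

FlushedRight : {m : ℕ} → Permutation′ m → Subset m → Set
FlushedRight {m} σ S =
  Consecutive σ S × Σ (Fin m) (λ i → suc (toℕ i) ≡ m × (σ ⟨$⟩ʳ i) ∈ S)

module Submission where

open import Defs
open import Data.Nat using (ℕ; suc; _<_; z≤n; s≤s⁻¹)
open import Data.Fin using (Fin; toℕ; _≤_)
open import Data.Fin.Properties using (toℕ<n; ≤-total)
open import Data.Fin.Subset using (Subset; _⊂_; _⊆_; ⊤; _∈_)
open import Data.Fin.Permutation using (Permutation′; _⟨$⟩ʳ_; _⟨$⟩ˡ_; inverseʳ)
open import Data.Product using (Σ; _×_; _,_)
open import Data.Sum using (_⊎_; inj₁; inj₂)
open import Relation.Nullary using (¬_)
open import Relation.Binary.PropositionalEquality using (_≡_; sym; subst)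

-- In τ the first element a lies in S₁ and the last element b in S₂.  Two sets
-- flushed Left in the same ordering σ are nested, so a ∈ S₂ or b ∈ S₁.  Either
-- way one of the sets contains both the first and the last element of τ and,
-- being consecutive there, is all of Ω, contradicting properness.

first-≤ : ∀ {m} {f : Fin m} (k : Fin m) → toℕ f ≡ 0 → f ≤ k
first-≤ k f≡0 rewrite f≡0 = z≤n

≤-last : ∀ {m} {l : Fin m} (k : Fin m) → suc (toℕ l) ≡ m → k ≤ l
≤-last k l≡m = s≤s⁻¹ (subst (toℕ k <_) (sym l≡m) (toℕ<n k))

consecutive-first-last⇒⊤⊆ : ∀ {m} {τ : Permutation′ m} {S : Subset m} {f l : Fin m} →
  Consecutive τ S → toℕ f ≡ 0 → suc (toℕ l) ≡ m →
  τ ⟨$⟩ʳ f ∈ S → τ ⟨$⟩ʳ l ∈ S → ⊤ ⊆ S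
consecutive-first-last⇒⊤⊆ {τ = τ} {S} consec f≡0 l≡m f∈S l∈S {x} _ =
  subst (_∈ S) (inverseʳ τ)
    (consec _ _ (τ ⟨$⟩ˡ x) (first-≤ _ f≡0) (≤-last _ l≡m) f∈S l∈S)

flushedLeft-downClosed : ∀ {m} {σ : Permutation′ m} {S : Subset m} {x y : Fin m} →
  FlushedLeft σ S → y ∈ S → σ ⟨$⟩ˡ x ≤ σ ⟨$⟩ˡ y → x ∈ S
flushedLeft-downClosed {σ = σ} {S} (consec , f , f≡0 , f∈S) y∈S x≤y =
  subst (_∈ S) (inverseʳ σ)
    (consec f _ _ (first-≤ _ f≡0) x≤y f∈S (subst (_∈ S) (sym (inverseʳ σ)) y∈S))

flushedLeft-nested : ∀ {m} {σ : Permutation′ m} {S T : Subset m} {x y : Fin m} →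
  FlushedLeft σ S → FlushedLeft σ T → x ∈ S → y ∈ T → y ∈ S ⊎ x ∈ T
flushedLeft-nested {σ = σ} {x = x} {y} flS flT x∈S y∈T
  with ≤-total (σ ⟨$⟩ˡ x) (σ ⟨$⟩ˡ y)
... | inj₁ x≤y = inj₂ (flushedLeft-downClosed {σ = σ} flT y∈T x≤y)
... | inj₂ y≤x = inj₁ (flushedLeft-downClosed {σ = σ} flS x∈S y≤x)

⊂⊤⇒¬⊤⊆ : ∀ {m} {S : Subset m} → S ⊂ ⊤ → ¬ (⊤ ⊆ S)
⊂⊤⇒¬⊤⊆ (_ , _ , x∈⊤ , x∉S) ⊤⊆S = x∉S (⊤⊆S x∈⊤)

lemma4p7 : (m : ℕ) (S₁ S₂ : Subset m) → S₁ ⊂ ⊤ → S₂ ⊂ ⊤ →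
    ¬ ((Σ (Permutation′ m) (λ σ → FlushedLeft σ S₁ × FlushedLeft σ S₂))
    × (Σ (Permutation′ m) (λ τ → FlushedLeft τ S₁ × FlushedRight τ S₂)))
lemma4p7 m S₁ S₂ S₁⊂⊤ S₂⊂⊤
  ( (σ , σ-left₁ , σ-left₂)
  , (τ , (consec₁ , f , f≡0 , first∈S₁) , (consec₂ , l , l≡m , last∈S₂)))
  with flushedLeft-nested {σ = σ} σ-left₁ σ-left₂ first∈S₁ last∈S₂
... | inj₁ last∈S₁ = ⊂⊤⇒¬⊤⊆ S₁⊂⊤ (consecutive-first-last⇒⊤⊆ {τ = τ} consec₁ f≡0 l≡m first∈S₁ last∈S₁)
... | inj₂ first∈S₂ = ⊂⊤⇒¬⊤⊆ S₂⊂⊤ (consecutive-first-last⇒⊤⊆ {τ = τ} consec₂ f≡0 l≡m first∈S₂ last∈S₂)
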